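{- If a sequent $\mathcal{G};\Gamma\vdash\Delta$ is derivable in $LS'_{PASL}+D$, then it is derivable in the proof system obtained from $LS'_{PASL}+D$ by replacing the rule $U$ with the rule $U'$.
   Context: Formulae: built from propositional variables $p$ and constants $\top,\bot,\top^*$ using $\land,\to,*,-\!*$. Labels: countably infinite set $\mathcal{L}$ with distinguished $\epsilon$. Relational atoms: $(a,b\triangleright c)$ and $a\neq b$. A sequent $\mathcal{G};\Gamma\vdash\Delta$ has a finite set $\mathcal{G}$ of relational atoms and finite sets $\Gamma,\Delta$ of labelled formulae $a:A$ (commas denote union). $X[a/b]$ denotes the result of replacing every occurrence of label $b$ in $X$ by $a$. The calculus $LS'_{PASL}+D$ (no cut) has rules (from premises infer conclusion): $(id)$ $\mathcal{G};\Gamma,w:p\vdash w:p,\Delta$; $(\bot L)$ $\mathcal{G};\Gamma,w:\bot\vdash\Delta$; $(\top R)$ $\mathcal{G};\Gamma\vdash w:\top,\Delta$; $(\top^*R)$ $\mathcal{G};\Gamma\vdash\epsilon:\top^*,\Delta$; $(NEq)$ $\mathcal{G}\cup\{w\neq w\};\Gamma\vdash\Delta$ (these have no premises). $(\top^*L)$: from $\mathcal{G}[\epsilon/w];\Gamma[\epsilon/w]\vdash\Delta[\epsilon/w]$ infer $\mathcal{G};\Gamma,w:\top^*\vdash\Delta$. $(\land L)$: from $\mathcal{G};\Gamma,w:A,w:B\vdash\Delta$ infer $\mathcal{G};\Gamma,w:A\land B\vdash\Delta$. $(\land R)$: from $\mathcal{G};\Gamma\vdash w:A,\Delta$ and $\mathcal{G};\Gamma\vdash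 w:B,\Delta$ infer $\mathcal{G};\Gamma\vdash w:A\land B,\Delta$. $(\to L)$: from $\mathcal{G};\Gamma\vdash w:A,\Delta$ and $\mathcal{G};\Gamma,w:B\vdash\Delta$ infer $\mathcal{G};\Gamma,w:A\to B\vdash\Delta$. $(\to R)$: from $\mathcal{G};\Gamma,w:A\vdash w:B,\Delta$ infer $\mathcal{G};\Gamma\vdash w:A\to B,\Delta$. $(*L)$: from $\mathcal{G}\cup\{(x,y\triangleright z)\};\Gamma,x:A,y:B\vdash\Delta$ infer $\mathcal{G};\Gamma,z:A*B\vdash\Delta$. $(-\!*R)$: from $\mathcal{G}\cup\{(x,z\triangleright y)\};\Gamma,x:A\vdash y:B,\Delta$ infer $\mathcal{G};\Gamma\vdash z:A-\!*B,\Delta$. (In $*L$ and $-\!*R$, $x,y$ do not occur in the conclusion.) $(*R)$: from $\mathcal{G}\cup\{(x,y\triangleright z)\};\Gamma\vdash x:A,z:A*B,\Delta$ and $\mathcal{G}\cup\{(x,y\triangleright z)\};\Gamma\vdash y:B,z:A*B,\Delta$ infer $\mathcal{G}\cup\{(x,y\triangleright z)\};\Gamma\vdash z:A*B,\Delta$. $(-\!*L)$: from $\mathcal{G}\cup\{(x,y\triangleright z)\};\Gamma,y:A-\!*B\vdash x:A,\Delta$ and $\mathcal{G}\cup\{(x,y\triangleright z)\};\Gamma,y:A-\!*B,z:B\vdash\Delta$ infer $\mathcal{G}\cup\{(x,y\triangleright z)\};\Gamma,y:A-\!*B\vdash\Delta$. $(EM)$: from $\mathcal{G}[x/y];\Gamma[x/y]\vdash\Delta[x/y]$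 and $\mathcal{G}\cup\{x\neq y\};\Gamma\vdash\Delta$ infer $\mathcal{G};\Gamma\vdash\Delta$. $(E_1)$: from $\mathcal{G}[x/z]\cup\{(x,\epsilon\triangleright x)\};\Gamma[x/z]\vdash\Delta[x/z]$ infer $\mathcal{G}\cup\{(x,\epsilon\triangleright z)\};\Gamma\vdash\Delta$. $(E_2)$: from $\mathcal{G}[z/x]\cup\{(z,\epsilon\triangleright z)\};\Gamma[z/x]\vdash\Delta[z/x]$ infer $\mathcal{G}\cup\{(x,\epsilon\triangleright z)\};\Gamma\vdash\Delta$. $(U)$: from $\mathcal{G}\cup\{(x,\epsilon\triangleright x)\};\Gamma\vdash\Delta$ infer $\mathcal{G};\Gamma\vdash\Delta$ (any label $x$). $(Com)$: from $\mathcal{G}\cup\{(y,x\triangleright z),(x,y\triangleright z)\};\Gamma\vdash\Delta$ infer $\mathcal{G}\cup\{(x,y\triangleright z)\};\Gamma\vdash\Delta$. $(A)$: from $\mathcal{G}\cup\{(u,y\triangleright x),(v,w\triangleright y),(z,w\triangleright x),(u,v\triangleright z)\};\Gamma\vdash\Delta$ infer $\mathcal{G}\cup\{(u,y\triangleright x),(v,w\triangleright y)\};\Gamma\vdash\Delta$, where $z$ does not occur in the conclusion. $(C)$: from $\mathcal{G}[y/w]\cup\{(x,y\triangleright z)\};\Gamma[y/w]\vdash\Delta[y/w]$ infer $\mathcal{G}\cup\{(x,y\triangleright z),(x,w\triangleright z)\};\Gamma\vdash\Delta$. $(P)$: from $\mathcal{G}[y/z]\cup\{(w,x\triangleright y)\};\Gamma[y/z]\vdash\Delta[y/z]$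 infer $\mathcal{G}\cup\{(w,x\triangleright y),(w,x\triangleright z)\};\Gamma\vdash\Delta$. $(D)$: from $\mathcal{G}[\epsilon/x]\cup\{(\epsilon,\epsilon\triangleright z)\};\Gamma[\epsilon/x]\vdash\Delta[\epsilon/x]$ infer $\mathcal{G}\cup\{(x,x\triangleright z)\};\Gamma\vdash\Delta$. The rule $U'$ is the restriction of $U$ to labels $x$ that occur in the conclusion $\mathcal{G};\Gamma\vdash\Delta$. A sequent is derivable if it is the root of a finite tree of rule instances whose leaves are instances of zero-premise rules. -}

module Defs where

open import Data.Nat using (ℕ; _≡ᵇ_)
open import Data.Bool using (if_then_else_)
open import Data.List using (List; []; _∷_; map)
open import Data.List.Relation.Unary.Any using (Any)
open import Data.List.Relation.Binary.Subset.Propositional using (_⊆_)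
open import Data.Product using (_×_; _,_)
open import Data.Sum using (_⊎_)
open import Data.Unit using (⊤)
open import Relation.Binary.PropositionalEquality using (_≡_; _≢_)
open import Relation.Nullary using (¬_)

Var : Set
Var = ℕ

data Formula : Set where
  var  : Var → Formula
  ⊤'   : Formula
  ⊥'   : Formula
  ⊤*   : Formula
  _∧'_ : Formula → Formula → Formula
  _⇒_  : Formula → Formula → Formula
  _✱_  : Formula → Formula → Formula
  _-✱_ : Formula → Formula → Formula

Label : Set
Label = ℕ

ε : Label
ε = 0

data RelAtom : Set where
  ⟨_,_▷_⟩ : Label → Label → Label → RelAtom
  _≠_     : Label → Label → RelAtom

data LFormula : Set where
  _∶_ : Label → Formula → LFormula

-- Finite sets are represented by lists; derivability
-- is closed under set-equality of the components (constructor setEq below),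
-- so it only depends on the underlying finite sets.
infix 6 _∶_
infix 6 _≠_
infix 2 _︔_⊢_
infixr 7 _∧'_ _⇒_ _✱_ _-✱_

record Sequent : Set where
  constructor _︔_⊢_
  field
    G : List RelAtom
    Γ : List LFormula
    Δ : List LFormula

[_/_]ℓ : Label → Label → Label → Label
[ a / b ]ℓ l = if l ≡ᵇ b then a else l

[_/_]R : Label → Label → RelAtom → RelAtom
[ a / b ]R ⟨ x , y ▷ z ⟩ = ⟨ [ a / b ]ℓ x , [ a / b ]ℓ y ▷ [ a / b ]ℓ z ⟩
[ a / b ]R (x ≠ y) = [ a / b ]ℓ x ≠ [ a / b ]ℓ y

[_/_]F : Label → Label → LFormula → LFormula
[ a / b ]F (x ∶ A) = [ a / b ]ℓ x ∶ A

[_/_] : Label → Label → Sequent → Sequent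
[ a / b ] (G ︔ Γ ⊢ Δ) = map [ a / b ]R G ︔ map [ a / b ]F Γ ⊢ map [ a / b ]F Δ

OccursR : Label → RelAtom → Set
OccursR l ⟨ a , b ▷ c ⟩ = l ≡ a ⊎ l ≡ b ⊎ l ≡ c
OccursR l (a ≠ b) = l ≡ a ⊎ l ≡ b

OccursF : Label → LFormula → Set
OccursF l (a ∶ A) = l ≡ a

Occurs : Label → Sequent → Set
Occurs l (G ︔ Γ ⊢ Δ) = Any (OccursR l) G ⊎ Any (OccursF l) Γ ⊎ Any (OccursF l) Δ

Fresh : Label → Sequent → Set
Fresh l S = ¬ Occurs l S × l ≢ ε

_≈ₛ_ : Sequent → Sequent → Set
(G ︔ Γ ⊢ Δ) ≈ₛ (G' ︔ Γ' ⊢ Δ') =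
  (G ⊆ G' × G' ⊆ G) × (Γ ⊆ Γ' × Γ' ⊆ Γ) × (Δ ⊆ Δ' × Δ' ⊆ Δ)

private
  variable
    G : List RelAtom
    Γ Δ : List LFormula
    w x y z u v : Label
    p : Var
    A B : Formula

-- The calculus LS'_PASL + D, parameterised by the side condition UOK x S
-- under which rule U may add (x, ε ▷ x) to the conclusion S.
data Derivable (UOK : Label → Sequent → Set) : Sequent → Set where
  setEq : ∀ {S S'} → S ≈ₛ S' → Derivable UOK S → Derivable UOK S'
  id   : Derivable UOK (G ︔ (w ∶ var p) ∷ Γ ⊢ (w ∶ var p) ∷ Δ)
  ⊥L   : Derivable UOK (G ︔ (w ∶ ⊥') ∷ Γ ⊢ Δ)
  ⊤R   : Derivable UOK (G ︔ Γ ⊢ (w ∶ ⊤') ∷ Δ)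
  ⊤*R  : Derivable UOK (G ︔ Γ ⊢ (ε ∶ ⊤*) ∷ Δ)
  NEq  : Derivable UOK ((w ≠ w) ∷ G ︔ Γ ⊢ Δ)
  ⊤*L  : Derivable UOK ([ ε / w ] (G ︔ Γ ⊢ Δ))
       → Derivable UOK (G ︔ (w ∶ ⊤*) ∷ Γ ⊢ Δ)
  ∧L   : Derivable UOK (G ︔ (w ∶ A) ∷ (w ∶ B) ∷ Γ ⊢ Δ)
       → Derivable UOK (G ︔ (w ∶ (A ∧' B)) ∷ Γ ⊢ Δ)
  ∧R   : Derivable UOK (G ︔ Γ ⊢ (w ∶ A) ∷ Δ)
       → Derivable UOK (G ︔ Γ ⊢ (w ∶ B) ∷ Δ)
       → Derivable UOK (G ︔ Γ ⊢ (w ∶ (A ∧' B)) ∷ Δ)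
  ⇒L   : Derivable UOK (G ︔ Γ ⊢ (w ∶ A) ∷ Δ)
       → Derivable UOK (G ︔ (w ∶ B) ∷ Γ ⊢ Δ)
       → Derivable UOK (G ︔ (w ∶ (A ⇒ B)) ∷ Γ ⊢ Δ)
  ⇒R   : Derivable UOK (G ︔ (w ∶ A) ∷ Γ ⊢ (w ∶ B) ∷ Δ)
       → Derivable UOK (G ︔ Γ ⊢ (w ∶ (A ⇒ B)) ∷ Δ)
  ✱L   : Fresh x (G ︔ (z ∶ (A ✱ B)) ∷ Γ ⊢ Δ)
       → Fresh y (G ︔ (z ∶ (A ✱ B)) ∷ Γ ⊢ Δ)
       → x ≢ y
       → Derivable UOK (⟨ x , y ▷ z ⟩ ∷ G ︔ (x ∶ A) ∷ (y ∶ B) ∷ Γ ⊢ Δ)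
       → Derivable UOK (G ︔ (z ∶ (A ✱ B)) ∷ Γ ⊢ Δ)
  -✱R  : Fresh x (G ︔ Γ ⊢ (z ∶ (A -✱ B)) ∷ Δ)
       → Fresh y (G ︔ Γ ⊢ (z ∶ (A -✱ B)) ∷ Δ)
       → x ≢ y
       → Derivable UOK (⟨ x , z ▷ y ⟩ ∷ G ︔ (x ∶ A) ∷ Γ ⊢ (y ∶ B) ∷ Δ)
       → Derivable UOK (G ︔ Γ ⊢ (z ∶ (A -✱ B)) ∷ Δ)
  ✱R   : Derivable UOK (⟨ x , y ▷ z ⟩ ∷ G ︔ Γ ⊢ (x ∶ A) ∷ (z ∶ (A ✱ B)) ∷ Δ)
       → Derivable UOK (⟨ x , y ▷ z ⟩ ∷ G ︔ Γ ⊢ (y ∶ B) ∷ (z ∶ (A ✱ B)) ∷ Δ)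
       → Derivable UOK (⟨ x , y ▷ z ⟩ ∷ G ︔ Γ ⊢ (z ∶ (A ✱ B)) ∷ Δ)
  -✱L  : Derivable UOK (⟨ x , y ▷ z ⟩ ∷ G ︔ (y ∶ (A -✱ B)) ∷ Γ ⊢ (x ∶ A) ∷ Δ)
       → Derivable UOK (⟨ x , y ▷ z ⟩ ∷ G ︔ (z ∶ B) ∷ (y ∶ (A -✱ B)) ∷ Γ ⊢ Δ)
       → Derivable UOK (⟨ x , y ▷ z ⟩ ∷ G ︔ (y ∶ (A -✱ B)) ∷ Γ ⊢ Δ)
  EM   : Derivable UOK ([ x / y ] (G ︔ Γ ⊢ Δ))
       → Derivable UOK ((x ≠ y) ∷ G ︔ Γ ⊢ Δ)
       → Derivable UOK (G ︔ Γ ⊢ Δ)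
  E₁   : Derivable UOK ((⟨ x , ε ▷ x ⟩ ∷ map [ x / z ]R G) ︔ map [ x / z ]F Γ ⊢ map [ x / z ]F Δ)
       → Derivable UOK (⟨ x , ε ▷ z ⟩ ∷ G ︔ Γ ⊢ Δ)
  E₂   : Derivable UOK ((⟨ z , ε ▷ z ⟩ ∷ map [ z / x ]R G) ︔ map [ z / x ]F Γ ⊢ map [ z / x ]F Δ)
       → Derivable UOK (⟨ x , ε ▷ z ⟩ ∷ G ︔ Γ ⊢ Δ)
  U    : UOK x (G ︔ Γ ⊢ Δ)
       → Derivable UOK (⟨ x , ε ▷ x ⟩ ∷ G ︔ Γ ⊢ Δ)
       → Derivable UOK (G ︔ Γ ⊢ Δ)
  Com  : Derivable UOK (⟨ y , x ▷ z ⟩ ∷ ⟨ x , y ▷ z ⟩ ∷ G ︔ Γ ⊢ Δ)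
       → Derivable UOK (⟨ x , y ▷ z ⟩ ∷ G ︔ Γ ⊢ Δ)
  Ass  : Fresh z (⟨ u , y ▷ x ⟩ ∷ ⟨ v , w ▷ y ⟩ ∷ G ︔ Γ ⊢ Δ)
       → Derivable UOK (⟨ u , y ▷ x ⟩ ∷ ⟨ v , w ▷ y ⟩ ∷ ⟨ z , w ▷ x ⟩ ∷ ⟨ u , v ▷ z ⟩ ∷ G ︔ Γ ⊢ Δ)
       → Derivable UOK (⟨ u , y ▷ x ⟩ ∷ ⟨ v , w ▷ y ⟩ ∷ G ︔ Γ ⊢ Δ)
  C    : Derivable UOK ((⟨ x , y ▷ z ⟩ ∷ map [ y / w ]R G) ︔ map [ y / w ]F Γ ⊢ map [ y / w ]F Δ)
       → Derivable UOK (⟨ x , y ▷ z ⟩ ∷ ⟨ x , w ▷ z ⟩ ∷ G ︔ Γ ⊢ Δ)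
  P    : Derivable UOK ((⟨ w , x ▷ y ⟩ ∷ map [ y / z ]R G) ︔ map [ y / z ]F Γ ⊢ map [ y / z ]F Δ)
       → Derivable UOK (⟨ w , x ▷ y ⟩ ∷ ⟨ w , x ▷ z ⟩ ∷ G ︔ Γ ⊢ Δ)
  D    : Derivable UOK ((⟨ ε , ε ▷ z ⟩ ∷ map [ ε / x ]R G) ︔ map [ ε / x ]F Γ ⊢ map [ ε / x ]F Δ)
       → Derivable UOK (⟨ x , x ▷ z ⟩ ∷ G ︔ Γ ⊢ Δ)

-- LS'_PASL + D with the unrestricted rule U (any label x)
LS+D : Sequent → Set
LS+D = Derivable (λ _ _ → ⊤)

-- The same system with U replaced by U' (x must occur in the conclusion)
LS+D-U' : Sequent → Set
LS+D-U' = Derivable Occurs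

module Submission where

-- We prove by induction on derivations a
-- relabelling-invariant strengthening (`transfer`): if S is derivable with U,
-- σ fixes ε and embeds S into T (the σ-image of each atom and formula of S lies
-- in T), then T is derivable with U'.  Each rule is replayed in T on σ-images,
-- the principal parts already in T being absorbed since sequents are sets;
-- eigenlabels (✱L, -✱R, A) are renamed beyond all labels of T (`bound`); label
-- substitutions (⊤*L, EM, E₁, E₂, C, P, D) are replayed on σ-images, oriented so
-- that ε is never replaced (`Mergeable`).  An instance of U at x is replayed at
-- σ x if that occurs in T; otherwise x is absent from S and may be sent to ε,
-- which an EM-split on ε and a label of T makes occur.  T cannot be empty: the
-- premise of U, valid in the one-point model (`sound`), would embed into an
-- invalid sequent.
-- The theorem is the instance σ = identity, T = S.

open import Defs
open import Data.Bool using (Bool; true; false; not; _∧_; _∨_)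
open import Data.Empty using (⊥; ⊥-elim)
open import Data.List using (List; []; _∷_; map)
open import Data.List.Membership.Propositional using (_∈_; find; lose)
open import Data.List.Membership.Propositional.Properties using (∈-map⁺; ∈-map⁻)
open import Data.List.Relation.Binary.Subset.Propositional.Properties
  using (⊆-refl; ∈-∷⁺ʳ; Any-resp-⊆; All-resp-⊇)
open import Data.List.Relation.Unary.All as All using (All; []; _∷_)
open import Data.List.Relation.Unary.All.Properties using (gmap⁺)
open import Data.List.Relation.Unary.Any as Any using (Any; here; there; any?; fromSum; toSum)
open import Data.List.Relation.Unary.Any.Properties using () renaming (map⁻ to Any-map⁻)
open import Data.Nat using (ℕ; suc; _+_; _≤_; _<_; _≟_; _≡ᵇ_; s≤s)
open import Data.Nat.ListAction using (sum)
open import Data.Nat.Properties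
  using (≡ᵇ⇒≡; ≡⇒≡ᵇ; ≤-reflexive; ≤-trans; n≤1+n; m≤m+n; m≤n+m; <-irrefl; 1+n≢n)
open import Data.Product using (_×_; _,_; proj₁; proj₂; ∃)
open import Data.Sum using (_⊎_; inj₁; inj₂)
open import Data.Unit using (⊤; tt)
open import Function using (_∘_)
open import Relation.Binary.PropositionalEquality
  using (_≡_; _≢_; refl; sym; trans; cong; cong₂; subst; ≢-sym)
open import Relation.Nullary using (¬_; Dec; yes; no)
open import Relation.Nullary.Decidable using (_⊎-dec_)

sub-hit : ∀ a b → [ a / b ]ℓ b ≡ a
sub-hit a b with b ≡ᵇ b | ≡⇒≡ᵇ b b refl
... | true  | _  = refl
... | false | ()

sub-miss : ∀ a b {l} → l ≢ b → [ a / b ]ℓ l ≡ l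
sub-miss a b {l} l≢b with l ≡ᵇ b | ≡ᵇ⇒≡ l b
... | true  | l≡b = ⊥-elim (l≢b (l≡b tt))
... | false | _   = refl

sub-self : ∀ a b → [ a / b ]ℓ a ≡ a
sub-self a b with a ≟ b
... | yes refl = sub-hit a a
... | no a≢b   = sub-miss a b a≢b

sub-identifies : ∀ a b → [ a / b ]ℓ a ≡ [ a / b ]ℓ b
sub-identifies a b = trans (sub-self a b) (sym (sub-hit a b))

sub-fixes-ε : ∀ a b → b ≢ ε → [ a / b ]ℓ ε ≡ ε
sub-fixes-ε a b b≢ε = sub-miss a b (≢-sym b≢ε)

sub-absorbed : ∀ (g : Label → Label) {x y} → g x ≡ g y → ∀ l → g ([ x / y ]ℓ l) ≡ g l
sub-absorbed g {x} {y} gx≡gy l with l ≟ y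
... | yes refl = trans (cong g (sub-hit x l)) gx≡gy
... | no l≢y   = cong g (sub-miss x y l≢y)

-- Soundness for the one-point model (used only to exclude an empty target).
-- In the one-point PAM every label denotes the unit world, every ternary atom
-- holds, no ≠-atom holds, ✱ and -✱ collapse to ∧ and ⇒, and we take every
-- propositional variable to be true.

⟦_⟧ : Formula → Bool
⟦ var _ ⟧  = true
⟦ ⊤' ⟧     = true
⟦ ⊥' ⟧     = false
⟦ ⊤* ⟧     = true
⟦ A ∧' B ⟧ = ⟦ A ⟧ ∧ ⟦ B ⟧
⟦ A ⇒ B ⟧  = not ⟦ A ⟧ ∨ ⟦ B ⟧
⟦ A ✱ B ⟧  = ⟦ A ⟧ ∧ ⟦ B ⟧
⟦ A -✱ B ⟧ = not ⟦ A ⟧ ∨ ⟦ B ⟧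

Holds : LFormula → Set
Holds (_ ∶ A) = ⟦ A ⟧ ≡ true

Ternary : RelAtom → Set
Ternary ⟨ _ , _ ▷ _ ⟩ = ⊤
Ternary (_ ≠ _)       = ⊥

Valid : Sequent → Set
Valid (G ︔ Γ ⊢ Δ) = All Ternary G → All Holds Γ → Any Holds Δ

∧-elim : ∀ {a b} → a ∧ b ≡ true → a ≡ true × b ≡ true
∧-elim {true} {true} _ = refl , refl

∧-intro : ∀ {a b} → a ≡ true → b ≡ true → a ∧ b ≡ true
∧-intro refl refl = refl

imp-elim : ∀ {a b} → not a ∨ b ≡ true → a ≡ true → b ≡ true
imp-elim h refl = h

imp-intro : ∀ a {b} {X : Set} → (a ≡ true → b ≡ true ⊎ X) → not a ∨ b ≡ true ⊎ X
imp-intro false _ = inj₁ refl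
imp-intro true  h = h refl

imp-left : ∀ {A B w Δ} → not ⟦ A ⟧ ∨ ⟦ B ⟧ ≡ true → Any Holds ((w ∶ A) ∷ Δ) →
           (⟦ B ⟧ ≡ true → Any Holds Δ) → Any Holds Δ
imp-left h (here a)  k = k (imp-elim h a)
imp-left _ (there q) _ = q

both-right : ∀ {P : LFormula → Set} {a b c xs} → (P a → P b → P c) →
             Any P (a ∷ xs) → Any P (b ∷ xs) → Any P (c ∷ xs)
both-right f (here pa) (here pb) = here (f pa pb)
both-right f (here _)  (there q) = there q
both-right f (there q) _         = there q

any-dedup : ∀ {P : LFormula → Set} {a xs} → Any P (a ∷ a ∷ xs) → Any P (a ∷ xs)
any-dedup (here p)  = here p
any-dedup (there q) = q

all-sub-rel : ∀ {a b G} → All Ternary G → All Ternary (map [ a / b ]R G)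
all-sub-rel = gmap⁺ λ { {⟨ _ , _ ▷ _ ⟩} _ → tt ; {_ ≠ _} () }

all-sub-ant : ∀ {a b Γ} → All Holds Γ → All Holds (map [ a / b ]F Γ)
all-sub-ant = gmap⁺ λ { {_ ∶ _} h → h }

any-unsub : ∀ {a b Δ} → Any Holds (map [ a / b ]F Δ) → Any Holds Δ
any-unsub = Any.map (λ { {_ ∶ _} h → h }) ∘ Any-map⁻

sound : ∀ {S} → LS+D S → Valid S
sound (setEq ((G⊆ , _) , (Γ⊆ , _) , (Δ⊆ , _)) d) tG hΓ =
  Any-resp-⊆ Δ⊆ (sound d (All-resp-⊇ G⊆ tG) (All-resp-⊇ Γ⊆ hΓ))
sound id  _ (h ∷ _)   = here h
sound ⊥L  _ (() ∷ _)
sound ⊤R  _ _         = here refl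
sound ⊤*R _ _         = here refl
sound NEq (() ∷ _) _
sound (⊤*L d) tG (_ ∷ hΓ) = any-unsub (sound d (all-sub-rel tG) (all-sub-ant hΓ))
sound (∧L d) tG (h ∷ hΓ) = sound d tG (proj₁ (∧-elim h) ∷ proj₂ (∧-elim h) ∷ hΓ)
sound (∧R d₁ d₂) tG hΓ = both-right ∧-intro (sound d₁ tG hΓ) (sound d₂ tG hΓ)
sound (⇒L {A = A} {B = B} d₁ d₂) tG (h ∷ hΓ) =
  imp-left {A = A} {B = B} h (sound d₁ tG hΓ) (λ b → sound d₂ tG (b ∷ hΓ))
sound (⇒R {A = A} d) tG hΓ =
  fromSum (imp-intro ⟦ A ⟧ (λ a → toSum (sound d tG (a ∷ hΓ))))
sound (✱L _ _ _ d) tG (h ∷ hΓ) = sound d (tt ∷ tG) (proj₁ (∧-elim h) ∷ proj₂ (∧-elim h) ∷ hΓ)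
sound (-✱R {A = A} _ _ _ d) tG hΓ =
  fromSum (imp-intro ⟦ A ⟧ (λ a → toSum (sound d (tt ∷ tG) (a ∷ hΓ))))
sound (✱R d₁ d₂) tG hΓ = any-dedup (both-right ∧-intro (sound d₁ tG hΓ) (sound d₂ tG hΓ))
sound (-✱L {A = A} {B = B} d₁ d₂) tG hΓ@(h ∷ _) =
  imp-left {A = A} {B = B} h (sound d₁ tG hΓ) (λ b → sound d₂ tG (b ∷ hΓ))
sound (EM d₁ _) tG hΓ = any-unsub (sound d₁ (all-sub-rel tG) (all-sub-ant hΓ))
sound (E₁ d) (_ ∷ tG) hΓ = any-unsub (sound d (tt ∷ all-sub-rel tG) (all-sub-ant hΓ))
sound (E₂ d) (_ ∷ tG) hΓ = any-unsub (sound d (tt ∷ all-sub-rel tG) (all-sub-ant hΓ))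
sound (U _ d) tG hΓ = sound d (tt ∷ tG) hΓ
sound (Com d) tG hΓ = sound d (tt ∷ tG) hΓ
sound (Ass _ d) (t₁ ∷ t₂ ∷ tG) hΓ = sound d (t₁ ∷ t₂ ∷ tt ∷ tt ∷ tG) hΓ
sound (C d) (_ ∷ _ ∷ tG) hΓ = any-unsub (sound d (tt ∷ all-sub-rel tG) (all-sub-ant hΓ))
sound (P d) (_ ∷ _ ∷ tG) hΓ = any-unsub (sound d (tt ∷ all-sub-rel tG) (all-sub-ant hΓ))
sound (D d) (_ ∷ tG) hΓ = any-unsub (sound d (tt ∷ all-sub-rel tG) (all-sub-ant hΓ))

empty-invalid : ∀ {a b c} → ¬ Valid (⟨ a , b ▷ c ⟩ ∷ [] ︔ [] ⊢ [])
empty-invalid v with v (tt ∷ []) []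
... | ()

mapR : (Label → Label) → RelAtom → RelAtom
mapR σ ⟨ a , b ▷ c ⟩ = ⟨ σ a , σ b ▷ σ c ⟩
mapR σ (a ≠ b)       = σ a ≠ σ b

mapF : (Label → Label) → LFormula → LFormula
mapF σ (a ∶ A) = σ a ∶ A

⟨⟩-cong : ∀ {a b c a' b' c'} → a ≡ a' → b ≡ b' → c ≡ c' → ⟨ a , b ▷ c ⟩ ≡ ⟨ a' , b' ▷ c' ⟩
⟨⟩-cong refl refl refl = refl

mapR-id : ∀ r → mapR (λ l → l) r ≡ r
mapR-id ⟨ _ , _ ▷ _ ⟩ = refl
mapR-id (_ ≠ _)       = refl

mapF-id : ∀ f → mapF (λ l → l) f ≡ f
mapF-id (_ ∶ _) = refl

mapR-cong : ∀ {σ τ} r → (∀ l → OccursR l r → σ l ≡ τ l) → mapR σ r ≡ mapR τ r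
mapR-cong ⟨ a , b ▷ c ⟩ h = ⟨⟩-cong (h a (inj₁ refl)) (h b (inj₂ (inj₁ refl))) (h c (inj₂ (inj₂ refl)))
mapR-cong (a ≠ b)       h = cong₂ _≠_ (h a (inj₁ refl)) (h b (inj₂ refl))

mapF-cong : ∀ {σ τ} f → (∀ l → OccursF l f → σ l ≡ τ l) → mapF σ f ≡ mapF τ f
mapF-cong (a ∶ A) h = cong (_∶ A) (h a refl)

mapR-post-sub : ∀ c d σ r → mapR ([ c / d ]ℓ ∘ σ) r ≡ [ c / d ]R (mapR σ r)
mapR-post-sub c d σ ⟨ _ , _ ▷ _ ⟩ = refl
mapR-post-sub c d σ (_ ≠ _)       = refl

mapF-post-sub : ∀ c d σ f → mapF ([ c / d ]ℓ ∘ σ) f ≡ [ c / d ]F (mapF σ f)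
mapF-post-sub c d σ (_ ∶ _) = refl

mapR-absorb : ∀ τ {x y} → τ x ≡ τ y → ∀ r → mapR τ ([ x / y ]R r) ≡ mapR τ r
mapR-absorb τ h ⟨ a , b ▷ c ⟩ =
  ⟨⟩-cong (sub-absorbed τ h a) (sub-absorbed τ h b) (sub-absorbed τ h c)
mapR-absorb τ h (a ≠ b) = cong₂ _≠_ (sub-absorbed τ h a) (sub-absorbed τ h b)

mapF-absorb : ∀ τ {x y} → τ x ≡ τ y → ∀ f → mapF τ ([ x / y ]F f) ≡ mapF τ f
mapF-absorb τ h (a ∶ A) = cong (_∶ A) (sub-absorbed τ h a)

occursR-map : ∀ σ {l} r → OccursR l r → OccursR (σ l) (mapR σ r)
occursR-map σ ⟨ _ , _ ▷ _ ⟩ (inj₁ refl)        = inj₁ refl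
occursR-map σ ⟨ _ , _ ▷ _ ⟩ (inj₂ (inj₁ refl)) = inj₂ (inj₁ refl)
occursR-map σ ⟨ _ , _ ▷ _ ⟩ (inj₂ (inj₂ refl)) = inj₂ (inj₂ refl)
occursR-map σ (_ ≠ _)       (inj₁ refl)        = inj₁ refl
occursR-map σ (_ ≠ _)       (inj₂ refl)        = inj₂ refl

update : (Label → Label) → Label → Label → Label → Label
update σ x a l with l ≟ x
... | yes _ = a
... | no _  = σ l

update-hit : ∀ σ x a → update σ x a x ≡ a
update-hit σ x a with x ≟ x
... | yes _   = refl
... | no x≢x  = ⊥-elim (x≢x refl)

update-miss : ∀ σ x a {l} → l ≢ x → update σ x a l ≡ σ l
update-miss σ x a {l} l≢x with l ≟ x
... | yes l≡x = ⊥-elim (l≢x l≡x)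
... | no _    = refl

update-to-ε : ∀ {σ} x → σ ε ≡ ε → update σ x ε ε ≡ ε
update-to-ε x σε with ε ≟ x
... | yes _ = refl
... | no _  = σε

_⊆⟨_⟩_ : {X Y : Set} → List X → (X → Y) → List Y → Set
L ⊆⟨ f ⟩ M = ∀ {a} → a ∈ L → f a ∈ M

module _ {X Y : Set} {f : X → Y} where

  ⊆-cons : ∀ {a L M} → f a ∈ M → L ⊆⟨ f ⟩ M → (a ∷ L) ⊆⟨ f ⟩ M
  ⊆-cons fa∈M e (here refl) = fa∈M
  ⊆-cons fa∈M e (there m)   = e m

  ⊆-tail : ∀ {a L M} → (a ∷ L) ⊆⟨ f ⟩ M → L ⊆⟨ f ⟩ M
  ⊆-tail e m = e (there m)

  ⊆-there : ∀ {b L M} → L ⊆⟨ f ⟩ M → L ⊆⟨ f ⟩ (b ∷ M)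
  ⊆-there e m = there (e m)

  ⊆-keep : ∀ {a L M} → L ⊆⟨ f ⟩ M → (a ∷ L) ⊆⟨ f ⟩ (f a ∷ M)
  ⊆-keep e = ⊆-cons (here refl) (⊆-there e)

  ⊆-agree : ∀ {g : X → Y} {L M} → (∀ {a} → a ∈ L → f a ≡ g a) → L ⊆⟨ g ⟩ M → L ⊆⟨ f ⟩ M
  ⊆-agree eq e m = subst (_∈ _) (sym (eq m)) (e m)

  ⊆-pre : ∀ {Z : Set} {h : Z → X} {L M} → L ⊆⟨ f ∘ h ⟩ M → map h L ⊆⟨ f ⟩ M
  ⊆-pre {h = h} e m with ∈-map⁻ h m
  ... | _ , a∈L , refl = e a∈L

  ⊆-post : ∀ {Z : Set} (h : Y → Z) {L M} → L ⊆⟨ f ⟩ M → L ⊆⟨ h ∘ f ⟩ map h M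
  ⊆-post h e m = ∈-map⁺ h (e m)

record Emb (σ : Label → Label) (S T : Sequent) : Set where
  constructor emb
  field
    rels : Sequent.G S ⊆⟨ mapR σ ⟩ Sequent.G T
    ants : Sequent.Γ S ⊆⟨ mapF σ ⟩ Sequent.Γ T
    sucs : Sequent.Δ S ⊆⟨ mapF σ ⟩ Sequent.Δ T
open Emb

emb-refl : ∀ {S} → Emb (λ l → l) S S
emb-refl = emb (⊆-agree (λ {r} _ → mapR-id r) (λ m → m))
               (⊆-agree (λ {f} _ → mapF-id f) (λ m → m))
               (⊆-agree (λ {f} _ → mapF-id f) (λ m → m))

emb-⊆ : ∀ {σ S S' T} → S ≈ₛ S' → Emb σ S' T → Emb σ S T
emb-⊆ ((G⊆ , _) , (Γ⊆ , _) , (Δ⊆ , _)) e =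
  emb (λ m → rels e (G⊆ m)) (λ m → ants e (Γ⊆ m)) (λ m → sucs e (Δ⊆ m))

emb-agree : ∀ {σ τ S T} → (∀ l → Occurs l S → τ l ≡ σ l) → Emb σ S T → Emb τ S T
emb-agree ag e =
  emb (⊆-agree (λ {r} m → mapR-cong r (λ l o → ag l (inj₁ (lose m o)))) (rels e))
      (⊆-agree (λ {f} m → mapF-cong f (λ l o → ag l (inj₂ (inj₁ (lose m o))))) (ants e))
      (⊆-agree (λ {f} m → mapF-cong f (λ l o → ag l (inj₂ (inj₂ (lose m o))))) (sucs e))

emb-update : ∀ {σ x a S T} → ¬ Occurs x S → Emb σ S T → Emb (update σ x a) S T
emb-update {S = S} x∉S =
  emb-agree (λ l o → update-miss _ _ _ (λ l≡x → x∉S (subst (λ k → Occurs k S) l≡x o)))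

emb-post-sub : ∀ {σ c d S T} → Emb σ S T → Emb ([ c / d ]ℓ ∘ σ) S ([ c / d ] T)
emb-post-sub {σ} {c} {d} e =
  emb (⊆-agree (λ {r} _ → mapR-post-sub c d σ r) (⊆-post [ c / d ]R (rels e)))
      (⊆-agree (λ {f} _ → mapF-post-sub c d σ f) (⊆-post [ c / d ]F (ants e)))
      (⊆-agree (λ {f} _ → mapF-post-sub c d σ f) (⊆-post [ c / d ]F (sucs e)))

emb-pre-merge : ∀ {τ x y S U} → τ x ≡ τ y → Emb τ S U → Emb τ ([ x / y ] S) U
emb-pre-merge {τ} h e =
  emb (⊆-pre (⊆-agree (λ {r} _ → mapR-absorb τ h r) (rels e)))
      (⊆-pre (⊆-agree (λ {f} _ → mapF-absorb τ h f) (ants e)))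
      (⊆-pre (⊆-agree (λ {f} _ → mapF-absorb τ h f) (sucs e)))

emb-merge : ∀ {σ x y c d S T} → [ c / d ]ℓ (σ x) ≡ [ c / d ]ℓ (σ y) →
            Emb σ S T → Emb ([ c / d ]ℓ ∘ σ) ([ x / y ] S) ([ c / d ] T)
emb-merge h e = emb-pre-merge h (emb-post-sub e)

occurs-emb : ∀ {σ S T l} → Emb σ S T → Occurs l S → Occurs (σ l) T
occurs-emb {σ} e (inj₁ o) with find o
... | r , m , o' = inj₁ (lose (rels e m) (occursR-map σ r o'))
occurs-emb e (inj₂ (inj₁ o)) with find o
... | (_ ∶ _) , m , refl = inj₂ (inj₁ (lose (ants e m) refl))
occurs-emb e (inj₂ (inj₂ o)) with find o
... | (_ ∶ _) , m , refl = inj₂ (inj₂ (lose (sucs e m) refl))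

valid-emb : ∀ {σ S T} → Emb σ S T → Valid S → Valid T
valid-emb {σ} {S} {T} e v tG hΓ =
  image (v (All.tabulate (λ {r} m → ternary r (All.lookup tG (rels e m))))
           (All.tabulate (λ {f} m → holds f (All.lookup hΓ (ants e m)))))
  where
  ternary : ∀ r → Ternary (mapR σ r) → Ternary r
  ternary ⟨ _ , _ ▷ _ ⟩ t = t
  holds : ∀ f → Holds (mapF σ f) → Holds f
  holds (_ ∶ _) h = h
  image : Any Holds (Sequent.Δ S) → Any Holds (Sequent.Δ T)
  image a with find a
  ... | (_ ∶ _) , m , h = lose (sucs e m) h

occursR? : ∀ l r → Dec (OccursR l r)
occursR? l ⟨ a , b ▷ c ⟩ = (l ≟ a) ⊎-dec (l ≟ b) ⊎-dec (l ≟ c)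
occursR? l (a ≠ b)       = (l ≟ a) ⊎-dec (l ≟ b)

occursF? : ∀ l f → Dec (OccursF l f)
occursF? l (a ∶ _) = l ≟ a

occurs? : ∀ l S → Dec (Occurs l S)
occurs? l (G ︔ Γ ⊢ Δ) = any? (occursR? l) G ⊎-dec any? (occursF? l) Γ ⊎-dec any? (occursF? l) Δ

labelled-or-empty : ∀ S → (∃ λ a → Occurs a S) ⊎ S ≡ ([] ︔ [] ⊢ [])
labelled-or-empty ((⟨ a , _ ▷ _ ⟩ ∷ _) ︔ _ ⊢ _) = inj₁ (a , inj₁ (here (inj₁ refl)))
labelled-or-empty (((a ≠ _) ∷ _) ︔ _ ⊢ _)       = inj₁ (a , inj₁ (here (inj₁ refl)))
labelled-or-empty ([] ︔ (a ∶ _) ∷ _ ⊢ _)         = inj₁ (a , inj₂ (inj₁ (here refl)))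
labelled-or-empty ([] ︔ [] ⊢ (a ∶ _) ∷ _)        = inj₁ (a , inj₂ (inj₂ (here refl)))
labelled-or-empty ([] ︔ [] ⊢ [])                 = inj₂ refl

weightR : RelAtom → ℕ
weightR ⟨ a , b ▷ c ⟩ = a + b + c
weightR (a ≠ b)       = a + b

weightF : LFormula → ℕ
weightF (a ∶ _) = a

-- A strict upper bound of the labels of S (hence every label from it on is fresh).
bound : Sequent → ℕ
bound (G ︔ Γ ⊢ Δ) = suc (sum (map weightR G) + sum (map weightF Γ) + sum (map weightF Δ))

≤-sum : ∀ {X : Set} {P : X → Set} {l} (w : X → ℕ) → (∀ {a} → P a → l ≤ w a) →
        ∀ {xs} → Any P xs → l ≤ sum (map w xs)
≤-sum w le (here p) = ≤-trans (le p) (m≤m+n _ _)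
≤-sum w le {x ∷ _} (there q) = ≤-trans (≤-sum w le q) (m≤n+m _ (w x))

occursR≤ : ∀ {l} r → OccursR l r → l ≤ weightR r
occursR≤ ⟨ a , b ▷ c ⟩ (inj₁ refl)        = ≤-trans (m≤m+n a b) (m≤m+n (a + b) c)
occursR≤ ⟨ a , b ▷ c ⟩ (inj₂ (inj₁ refl)) = ≤-trans (m≤n+m b a) (m≤m+n (a + b) c)
occursR≤ ⟨ a , b ▷ c ⟩ (inj₂ (inj₂ refl)) = m≤n+m c (a + b)
occursR≤ (a ≠ b)       (inj₁ refl)        = m≤m+n a b
occursR≤ (a ≠ b)       (inj₂ refl)        = m≤n+m b a

occursF≤ : ∀ {l} f → OccursF l f → l ≤ weightF f
occursF≤ (_ ∶ _) refl = ≤-reflexive refl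

occurs<bound : ∀ {l} S → Occurs l S → l < bound S
occurs<bound (G ︔ Γ ⊢ Δ) (inj₁ o) =
  s≤s (≤-trans (≤-sum weightR (λ {r} → occursR≤ r) o) (≤-trans (m≤m+n _ _) (m≤m+n _ _)))
occurs<bound (G ︔ Γ ⊢ Δ) (inj₂ (inj₁ o)) =
  s≤s (≤-trans (≤-sum weightF (λ {f} → occursF≤ f) o)
               (≤-trans (m≤n+m _ (sum (map weightR G))) (m≤m+n _ _)))
occurs<bound (G ︔ Γ ⊢ Δ) (inj₂ (inj₂ o)) =
  s≤s (≤-trans (≤-sum weightF (λ {f} → occursF≤ f) o) (m≤n+m _ _))

fresh-beyond : ∀ {S T k} → Emb (λ l → l) S T → bound T ≤ k → Fresh k S
fresh-beyond {T = T} e le@(s≤s _) =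
  (λ o → <-irrefl refl (≤-trans (occurs<bound T (occurs-emb e o)) le)) , λ ()

fresh-update : ∀ {σ x a S T} → Fresh x S → σ ε ≡ ε →
               Emb σ S T → update σ x a ε ≡ ε × Emb (update σ x a) S T
fresh-update (x∉S , x≢ε) σε e = trans (update-miss _ _ _ (≢-sym x≢ε)) σε , emb-update x∉S e

-- A rule may be applied to a sequent that already contains its principal
-- atom or formula: the conclusion absorbs the duplicate.
module _ {R : Label → Sequent → Set} where

  contract-rel : ∀ {k G Γ Δ} → k ∈ G → Derivable R (k ∷ G ︔ Γ ⊢ Δ) → Derivable R (G ︔ Γ ⊢ Δ)
  contract-rel k∈G = setEq ((∈-∷⁺ʳ k∈G ⊆-refl , there) , (⊆-refl , ⊆-refl) , (⊆-refl , ⊆-refl))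

  contract-rel₂ : ∀ {k k' G Γ Δ} → k ∈ G → k' ∈ G →
                  Derivable R (k ∷ k' ∷ G ︔ Γ ⊢ Δ) → Derivable R (G ︔ Γ ⊢ Δ)
  contract-rel₂ k∈G k'∈G = contract-rel k'∈G ∘ contract-rel (there k∈G)

  contract-ant : ∀ {f G Γ Δ} → f ∈ Γ → Derivable R (G ︔ f ∷ Γ ⊢ Δ) → Derivable R (G ︔ Γ ⊢ Δ)
  contract-ant f∈Γ = setEq ((⊆-refl , ⊆-refl) , (∈-∷⁺ʳ f∈Γ ⊆-refl , there) , (⊆-refl , ⊆-refl))

  contract-suc : ∀ {f G Γ Δ} → f ∈ Δ → Derivable R (G ︔ Γ ⊢ f ∷ Δ) → Derivable R (G ︔ Γ ⊢ Δ)
  contract-suc f∈Δ = setEq ((⊆-refl , ⊆-refl) , (⊆-refl , ⊆-refl) , (∈-∷⁺ʳ f∈Δ ⊆-refl , there))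

  -- After [ a / b ], the atom b ≠ a has become a ≠ a.
  identified-≠ : ∀ a b {G Γ Δ} → Derivable R (([ a / b ]ℓ b ≠ [ a / b ]ℓ a) ∷ G ︔ Γ ⊢ Δ)
  identified-≠ a b rewrite sub-hit a b | sub-self a b = NEq

_◁_ : RelAtom → Sequent → Sequent
k ◁ (G ︔ Γ ⊢ Δ) = (k ∷ G) ︔ Γ ⊢ Δ

-- T survives every ε-fixing substitution identifying a and b, even with an
-- extra atom: what the premises of E₁, E₂, C, P and D need.
Mergeable : Sequent → Label → Label → Set
Mergeable T a b =
  ∀ c d → [ c / d ]ℓ ε ≡ ε → [ c / d ]ℓ a ≡ [ c / d ]ℓ b → ∀ k → LS+D-U' (k ◁ [ c / d ] T)

mergeable-sym : ∀ {T a b} → Mergeable T a b → Mergeable T b a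
mergeable-sym M c d cε h = M c d cε (sym h)

-- The substitution rules are oriented so that ε is never the label replaced.
E-target : ∀ {a b T} → ⟨ a , ε ▷ b ⟩ ∈ Sequent.G T → Mergeable T a b → LS+D-U' T
E-target {a} {b} m M with b ≟ ε
... | no b≢ε   = contract-rel m (E₁ (M a b (sub-fixes-ε a b b≢ε) (sub-identifies a b) ⟨ a , ε ▷ a ⟩))
... | yes refl = contract-rel m (E₂ (M ε a (sub-self ε a) (sym (sub-identifies ε a)) ⟨ ε , ε ▷ ε ⟩))

C-target : ∀ {a b c w T} → ⟨ a , b ▷ c ⟩ ∈ Sequent.G T → ⟨ a , w ▷ c ⟩ ∈ Sequent.G T →
           Mergeable T b w → LS+D-U' T
C-target {a} {b} {c} {w} m₁ m₂ M with w ≟ ε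
... | no w≢ε   = contract-rel₂ m₁ m₂ (C (M b w (sub-fixes-ε b w w≢ε) (sub-identifies b w) ⟨ a , b ▷ c ⟩))
... | yes refl = contract-rel₂ m₂ m₁ (C (M ε b (sub-self ε b) (sym (sub-identifies ε b)) ⟨ a , ε ▷ c ⟩))

P-target : ∀ {w x y z T} → ⟨ w , x ▷ y ⟩ ∈ Sequent.G T → ⟨ w , x ▷ z ⟩ ∈ Sequent.G T →
           Mergeable T y z → LS+D-U' T
P-target {w} {x} {y} {z} m₁ m₂ M with z ≟ ε
... | no z≢ε   = contract-rel₂ m₁ m₂ (P (M y z (sub-fixes-ε y z z≢ε) (sub-identifies y z) ⟨ w , x ▷ y ⟩))
... | yes refl = contract-rel₂ m₂ m₁ (P (M ε y (sub-self ε y) (sym (sub-identifies ε y)) ⟨ w , x ▷ ε ⟩))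

D-target : ∀ {a b T} → ⟨ a , a ▷ b ⟩ ∈ Sequent.G T → Mergeable T ε a → LS+D-U' T
D-target {a} {b} m M = contract-rel m (D (M ε a (sub-self ε a) (sub-identifies ε a) ⟨ ε , ε ▷ b ⟩))

Transfer : Sequent → Set
Transfer S = ∀ σ → σ ε ≡ ε → ∀ {T} → Emb σ S T → LS+D-U' T

transfer-sub : ∀ {x y S σ T} c d → Transfer ([ x / y ] S) → σ ε ≡ ε → [ c / d ]ℓ ε ≡ ε →
               [ c / d ]ℓ (σ x) ≡ [ c / d ]ℓ (σ y) → Emb σ S T → LS+D-U' ([ c / d ] T)
transfer-sub {σ = σ} c d IH σε cε h e =
  IH ([ c / d ]ℓ ∘ σ) (trans (cong [ c / d ]ℓ σε) cε) (emb-merge h e)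

merge-premise : ∀ {k r x y G Γ Δ σ T} →
                Transfer (k ◁ [ x / y ] (G ︔ Γ ⊢ Δ)) → (∀ τ → τ x ≡ τ y → mapR τ k ≡ mapR τ r) →
                σ ε ≡ ε → mapR σ r ∈ Sequent.G T → Emb σ (G ︔ Γ ⊢ Δ) T → Mergeable T (σ x) (σ y)
merge-premise {k} {r} {σ = σ} {T} IH k≈r σε r∈T e c d cε h _ =
  IH τ (trans (cong [ c / d ]ℓ σε) cε)
     (emb (⊆-cons (there k-image) (⊆-there (rels e'))) (ants e') (sucs e'))
  where
  τ = [ c / d ]ℓ ∘ σ
  e' = emb-merge h e
  k-image : mapR τ k ∈ map [ c / d ]R (Sequent.G T)
  k-image = subst (_∈ _) (sym (trans (k≈r τ h) (mapR-post-sub c d σ r))) (∈-map⁺ [ c / d ]R r∈T)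

transfer-EM : ∀ {x y G Γ Δ} → Transfer ([ x / y ] (G ︔ Γ ⊢ Δ)) →
              Transfer ((x ≠ y) ∷ G ︔ Γ ⊢ Δ) → Transfer (G ︔ Γ ⊢ Δ)
transfer-EM {x} {y} IH₁ IH₂ σ σε e with σ y ≟ ε
... | no σy≢ε =
  EM {x = σ x} {y = σ y}
     (transfer-sub (σ x) (σ y) IH₁ σε (sub-fixes-ε _ _ σy≢ε) (sub-identifies (σ x) (σ y)) e)
     (IH₂ σ σε (emb (⊆-keep (rels e)) (ants e) (sucs e)))
-- σ y = ε must not be replaced: split on σ y = σ x instead, and recover the
-- atom σ x ≠ σ y from σ y ≠ σ x by a further split.
... | yes σy≡ε =
  EM {x = σ y} {y = σ x}
     (transfer-sub (σ y) (σ x) IH₁ σε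
                   (subst (λ c → [ c / σ x ]ℓ ε ≡ ε) (sym σy≡ε) (sub-self ε (σ x)))
                   (sym (sub-identifies (σ y) (σ x))) e)
     (EM {x = σ x} {y = σ y} (identified-≠ (σ x) (σ y))
         (IH₂ σ σε (emb (⊆-keep (⊆-there (rels e))) (ants e) (sucs e))))

record Eigen₂ (x y : Label) (S T : Sequent) : Set where
  field
    τ        : Label → Label
    fixes-ε  : τ ε ≡ ε
    embeds   : Emb τ S T
    x-new    : bound T ≤ τ x
    y-new    : bound T ≤ τ y
    distinct : τ x ≢ τ y

eigen₂ : ∀ {x y σ S T} → Fresh x S → Fresh y S → x ≢ y → σ ε ≡ ε → Emb σ S T → Eigen₂ x y S T
eigen₂ {x} {y} {σ} {S} {T} fx fy x≢y σε e = record
  { τ        = τ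
  ; fixes-ε  = proj₁ step₂
  ; embeds   = proj₂ step₂
  ; x-new    = ≤-reflexive (sym τx)
  ; y-new    = ≤-trans (n≤1+n _) (≤-reflexive (sym τy))
  ; distinct = λ eq → 1+n≢n (sym (trans (sym τx) (trans eq τy)))
  }
  where
  σ₁ = update σ x (bound T)
  τ  = update σ₁ y (suc (bound T))
  step₁ = fresh-update {a = bound T} fx σε e
  step₂ = fresh-update {a = suc (bound T)} fy (proj₁ step₁) (proj₂ step₁)
  τx : τ x ≡ bound T
  τx = trans (update-miss σ₁ y (suc (bound T)) x≢y) (update-hit σ x (bound T))
  τy : τ y ≡ suc (bound T)
  τy = update-hit σ₁ y (suc (bound T))

transfer-✱L : ∀ {x y z A B G Γ Δ} →
              Fresh x (G ︔ (z ∶ A ✱ B) ∷ Γ ⊢ Δ) → Fresh y (G ︔ (z ∶ A ✱ B) ∷ Γ ⊢ Δ) → x ≢ y →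
              Transfer (⟨ x , y ▷ z ⟩ ∷ G ︔ (x ∶ A) ∷ (y ∶ B) ∷ Γ ⊢ Δ) →
              Transfer (G ︔ (z ∶ A ✱ B) ∷ Γ ⊢ Δ)
transfer-✱L {z = z} {A} {B} fx fy x≢y IH σ σε {T} e =
  contract-ant z∈T (✱L (fresh-beyond T₀↪T x-new) (fresh-beyond T₀↪T y-new) distinct
    (IH τ fixes-ε (emb (⊆-keep (rels embeds)) (⊆-keep (⊆-keep (⊆-tail (ants embeds))))
                       (sucs embeds))))
  where
  open Eigen₂ (eigen₂ fx fy x≢y σε e)
  z∈T = ants embeds (here refl)
  T₀↪T : Emb (λ l → l) (Sequent.G T ︔ (τ z ∶ A ✱ B) ∷ Sequent.Γ T ⊢ Sequent.Δ T) T
  T₀↪T = emb (rels (emb-refl {T})) (⊆-cons z∈T (ants (emb-refl {T}))) (sucs (emb-refl {T}))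

transfer--✱R : ∀ {x y z A B G Γ Δ} →
               Fresh x (G ︔ Γ ⊢ (z ∶ A -✱ B) ∷ Δ) → Fresh y (G ︔ Γ ⊢ (z ∶ A -✱ B) ∷ Δ) → x ≢ y →
               Transfer (⟨ x , z ▷ y ⟩ ∷ G ︔ (x ∶ A) ∷ Γ ⊢ (y ∶ B) ∷ Δ) →
               Transfer (G ︔ Γ ⊢ (z ∶ A -✱ B) ∷ Δ)
transfer--✱R {z = z} {A} {B} fx fy x≢y IH σ σε {T} e =
  contract-suc z∈T (-✱R (fresh-beyond T₀↪T x-new) (fresh-beyond T₀↪T y-new) distinct
    (IH τ fixes-ε (emb (⊆-keep (rels embeds)) (⊆-keep (ants embeds))
                       (⊆-keep (⊆-tail (sucs embeds))))))
  where
  open Eigen₂ (eigen₂ fx fy x≢y σε e)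
  z∈T = sucs embeds (here refl)
  T₀↪T : Emb (λ l → l) (Sequent.G T ︔ Sequent.Γ T ⊢ (τ z ∶ A -✱ B) ∷ Sequent.Δ T) T
  T₀↪T = emb (rels (emb-refl {T})) (ants (emb-refl {T})) (⊆-cons z∈T (sucs (emb-refl {T})))

transfer-Ass : ∀ {u v w x y z G Γ Δ} →
               Fresh z (⟨ u , y ▷ x ⟩ ∷ ⟨ v , w ▷ y ⟩ ∷ G ︔ Γ ⊢ Δ) →
               Transfer (⟨ u , y ▷ x ⟩ ∷ ⟨ v , w ▷ y ⟩ ∷ ⟨ z , w ▷ x ⟩ ∷ ⟨ u , v ▷ z ⟩ ∷ G ︔ Γ ⊢ Δ) →
               Transfer (⟨ u , y ▷ x ⟩ ∷ ⟨ v , w ▷ y ⟩ ∷ G ︔ Γ ⊢ Δ)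
transfer-Ass {u} {v} {w} {x} {y} {z} fz IH σ σε {T} e =
  contract-rel₂ m₁ m₂ (Ass (fresh-beyond T₀↪T (≤-reflexive (sym (update-hit σ z (bound T)))))
    (IH τ (proj₁ step) (emb (⊆-keep (⊆-keep (⊆-keep (⊆-keep (⊆-tail (⊆-tail (rels e')))))))
                            (ants e') (sucs e'))))
  where
  τ = update σ z (bound T)
  step = fresh-update {a = bound T} fz σε e
  e' = proj₂ step
  m₁ = rels e' (here refl)
  m₂ = rels e' (there (here refl))
  T₀↪T : Emb (λ l → l)
             (⟨ τ u , τ y ▷ τ x ⟩ ∷ ⟨ τ v , τ w ▷ τ y ⟩ ∷ Sequent.G T ︔ Sequent.Γ T ⊢ Sequent.Δ T) T
  T₀↪T = emb (⊆-cons m₁ (⊆-cons m₂ (rels (emb-refl {T})))) (ants (emb-refl {T}))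
             (sucs (emb-refl {T}))

U-at : ∀ {x a G Γ Δ σ T} → Transfer (⟨ x , ε ▷ x ⟩ ∷ G ︔ Γ ⊢ Δ) → σ ε ≡ ε → σ x ≡ a →
       Occurs a T → Emb σ (G ︔ Γ ⊢ Δ) T → LS+D-U' T
U-at {a = a} IH σε σx a∈T e =
  U {x = a} a∈T
    (IH _ σε (emb (⊆-cons (here (⟨⟩-cong σx σε σx)) (⊆-there (rels e))) (ants e) (sucs e)))

-- U at a label x absent from S whose image is absent from T: send x to ε,
-- after an EM-split on ε and a label a of T makes ε occur in both branches.
U-absent : ∀ {x G Γ Δ σ T} → ¬ Occurs x (G ︔ Γ ⊢ Δ) → Valid (⟨ x , ε ▷ x ⟩ ∷ G ︔ Γ ⊢ Δ) →
           Transfer (⟨ x , ε ▷ x ⟩ ∷ G ︔ Γ ⊢ Δ) → σ ε ≡ ε → Emb σ (G ︔ Γ ⊢ Δ) T → LS+D-U' T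
U-absent {x} {σ = σ} {T} x∉S valid IH σε e with labelled-or-empty T
... | inj₂ refl =
  ⊥-elim (empty-invalid (valid-emb (emb (⊆-keep (rels e)) (ants e) (sucs e)) valid))
... | inj₁ (a , a∈T) =
  EM {x = ε} {y = a}
     (U-at IH (trans (cong [ ε / a ]ℓ σ₀ε) (sub-self ε a))
              (trans (cong [ ε / a ]ℓ (update-hit σ x ε)) (sub-self ε a))
              ε∈T[ε/a] (emb-post-sub e₀))
     (U-at IH σ₀ε (update-hit σ x ε) (inj₁ (here (inj₁ refl)))
              (emb (⊆-there (rels e₀)) (ants e₀) (sucs e₀)))
  where
  σ₀ = update σ x ε
  σ₀ε : σ₀ ε ≡ ε
  σ₀ε = update-to-ε x σε
  e₀ : Emb σ₀ _ T
  e₀ = emb-update x∉S e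
  ε∈T[ε/a] : Occurs ε ([ ε / a ] T)
  ε∈T[ε/a] = subst (λ l → Occurs l ([ ε / a ] T)) (sub-hit ε a)
                   (occurs-emb (emb-post-sub emb-refl) a∈T)

transfer-U : ∀ {x G Γ Δ} → Valid (⟨ x , ε ▷ x ⟩ ∷ G ︔ Γ ⊢ Δ) →
             Transfer (⟨ x , ε ▷ x ⟩ ∷ G ︔ Γ ⊢ Δ) → Transfer (G ︔ Γ ⊢ Δ)
transfer-U {x} valid IH σ σε {T} e with occurs? (σ x) T
... | yes σx∈T = U-at IH σε refl σx∈T e
... | no σx∉T  = U-absent (λ x∈S → σx∉T (occurs-emb e x∈S)) valid IH σε e

transfer : ∀ {S} → LS+D S → Transfer S
transfer (setEq {S = S} S≈S' d) σ σε e = transfer d σ σε (emb-⊆ {S = S} S≈S' e)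
transfer id  σ σε e = contract-ant (ants e (here refl)) (contract-suc (sucs e (here refl)) id)
transfer ⊥L  σ σε e = contract-ant (ants e (here refl)) ⊥L
transfer ⊤R  σ σε e = contract-suc (sucs e (here refl)) ⊤R
transfer ⊤*R σ σε e = contract-suc (subst (λ l → (l ∶ ⊤*) ∈ _) σε (sucs e (here refl))) ⊤*R
transfer NEq σ σε e = contract-rel (rels e (here refl)) NEq
transfer (⊤*L {w = w} d) σ σε e =
  contract-ant (ants e (here refl))
    (⊤*L (transfer-sub ε (σ w) (transfer d) σε (sub-self ε (σ w))
                       (trans (cong [ ε / σ w ]ℓ σε) (sub-identifies ε (σ w)))
                       (emb (rels e) (⊆-tail (ants e)) (sucs e))))
transfer (∧L d) σ σε e =
  contract-ant (ants e (here refl))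
    (∧L (transfer d σ σε (emb (rels e) (⊆-keep (⊆-keep (⊆-tail (ants e)))) (sucs e))))
transfer (∧R d₁ d₂) σ σε e =
  contract-suc (sucs e (here refl))
    (∧R (transfer d₁ σ σε (emb (rels e) (ants e) (⊆-keep (⊆-tail (sucs e)))))
        (transfer d₂ σ σε (emb (rels e) (ants e) (⊆-keep (⊆-tail (sucs e))))))
transfer (⇒L d₁ d₂) σ σε e =
  contract-ant (ants e (here refl))
    (⇒L (transfer d₁ σ σε (emb (rels e) (⊆-tail (ants e)) (⊆-keep (sucs e))))
        (transfer d₂ σ σε (emb (rels e) (⊆-keep (⊆-tail (ants e))) (sucs e))))
transfer (⇒R d) σ σε e =
  contract-suc (sucs e (here refl))
    (⇒R (transfer d σ σε (emb (rels e) (⊆-keep (ants e)) (⊆-keep (⊆-tail (sucs e))))))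
transfer (✱L fx fy x≢y d) = transfer-✱L fx fy x≢y (transfer d)
transfer (-✱R fx fy x≢y d) = transfer--✱R fx fy x≢y (transfer d)
transfer (✱R d₁ d₂) σ σε e =
  contract-rel (rels e (here refl)) (contract-suc (sucs e (here refl))
    (✱R (transfer d₁ σ σε (emb (⊆-keep (⊆-tail (rels e))) (ants e)
                               (⊆-keep (⊆-keep (⊆-tail (sucs e))))))
        (transfer d₂ σ σε (emb (⊆-keep (⊆-tail (rels e))) (ants e)
                               (⊆-keep (⊆-keep (⊆-tail (sucs e))))))))
transfer (-✱L d₁ d₂) σ σε e =
  contract-rel (rels e (here refl)) (contract-ant (ants e (here refl))
    (-✱L (transfer d₁ σ σε (emb (⊆-keep (⊆-tail (rels e))) (⊆-keep (⊆-tail (ants e)))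
                                (⊆-keep (sucs e))))
         (transfer d₂ σ σε (emb (⊆-keep (⊆-tail (rels e))) (⊆-keep (⊆-keep (⊆-tail (ants e))))
                                (sucs e)))))
transfer (EM d₁ d₂) = transfer-EM (transfer d₁) (transfer d₂)
transfer (E₁ {x = x} {z = z} d) σ σε e =
  E-target (subst (λ l → ⟨ σ x , l ▷ σ z ⟩ ∈ _) σε (rels e (here refl)))
    (merge-premise {x = x} {y = z} (transfer d) (λ τ h → cong (λ l → ⟨ τ x , τ ε ▷ l ⟩) h)
                   σε (rels e (here refl)) (emb (⊆-tail (rels e)) (ants e) (sucs e)))
transfer (E₂ {z = z} {x = x} d) σ σε {T} e =
  E-target (subst (λ l → ⟨ σ x , l ▷ σ z ⟩ ∈ _) σε (rels e (here refl)))
    (mergeable-sym {T = T} {σ z} {σ x}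
      (merge-premise {x = z} {y = x} (transfer d) (λ τ h → cong (λ l → ⟨ l , τ ε ▷ τ z ⟩) h)
                     σε (rels e (here refl)) (emb (⊆-tail (rels e)) (ants e) (sucs e))))
transfer (U _ d) = transfer-U (sound d) (transfer d)
transfer (Com d) σ σε e =
  contract-rel (rels e (here refl))
    (Com (transfer d σ σε (emb (⊆-keep (⊆-keep (⊆-tail (rels e)))) (ants e) (sucs e))))
transfer (Ass fz d) = transfer-Ass fz (transfer d)
transfer (C {y = y} {w = w} d) σ σε e =
  C-target (rels e (here refl)) (rels e (there (here refl)))
    (merge-premise {x = y} {y = w} (transfer d) (λ _ _ → refl)
                   σε (rels e (here refl)) (emb (⊆-tail (⊆-tail (rels e))) (ants e) (sucs e)))
transfer (P {y = y} {z = z} d) σ σε e =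
  P-target (rels e (here refl)) (rels e (there (here refl)))
    (merge-premise {x = y} {y = z} (transfer d) (λ _ _ → refl)
                   σε (rels e (here refl)) (emb (⊆-tail (⊆-tail (rels e))) (ants e) (sucs e)))
transfer (D {z = z} {x = x} d) σ σε e =
  D-target (rels e (here refl))
    (subst (λ l → Mergeable _ l (σ x)) σε
      (merge-premise {x = ε} {y = x} (transfer d) (λ τ h → ⟨⟩-cong h h refl)
                     σε (rels e (here refl)) (emb (⊆-tail (rels e)) (ants e) (sucs e))))

lemma6p1 : (S : Sequent) → LS+D S → LS+D-U' S
lemma6p1 S d = transfer d (λ l → l) refl emb-refl
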